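{- For every integer $n\ge0$, the number of bracketings of the expression $0\,\hat{}\,0\,\hat{}\cdots\hat{}\,0$ with $n+1$ zeroes whose value is $1$ equals the number of walks of length $n$ with steps in $\{ -2,-1,+1,+2\}$ from altitude $0$ to altitude $2$ having altitude strictly greater than $0$ at every point after the start.
   Context: A bracketing of a sequence of $N$ zeroes is a full parenthesization of the binary operation $x\,\hat{}\,y=x^y$ applied to the sequence (equivalently a binary tree with $N$ leaves labelled $0$); it is evaluated with the conventions $1^1=1^0=0^0=1$ and $0^1=0$. A walk moves one unit right and $s$ units vertically for each step $s$. -}

module Defs where

open import Data.Nat using (ℕ; zero; suc; _+_)
open import Data.Integer using (ℤ; +_; -[1+_]; _<_) renaming (_+_ to _+ℤ_)
open import Data.Bool using (Bool; true; false)
open import Data.Vec using (Vec; []; _∷_)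
open import Data.Unit using (⊤)
open import Data.Product using (_×_)
open import Relation.Binary.PropositionalEquality using (_≡_)

-- Full binary trees with exactly k leaves (all leaves labelled 0).
-- A bracketing of k zeroes is such a tree.
data Bracketing : ℕ → Set where
  leaf : Bracketing 1
  node : ∀ {i j} → Bracketing (suc i) → Bracketing (suc j) → Bracketing (suc i + suc j)

-- x ^ y on {0,1}, encoded false = 0, true = 1:
-- 1^1 = 1^0 = 0^0 = 1 and 0^1 = 0.
pow : Bool → Bool → Bool
pow true  _     = true
pow false false = true
pow false true  = false

value : ∀ {k} → Bracketing k → Bool
value leaf       = false
value (node l r) = pow (value l) (value r)

data Step : Set where
  m2 m1 p1 p2 : Step

stepVal : Step → ℤ
stepVal m2 = -[1+ 1 ]
stepVal m1 = -[1+ 0 ]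
stepVal p1 = + 1
stepVal p2 = + 2

PositiveWalkTo2From : ∀ {n} → ℤ → Vec Step n → Set
PositiveWalkTo2From h []       = h ≡ + 2
PositiveWalkTo2From h (s ∷ ss) = (+ 0 < h +ℤ stepVal s) × PositiveWalkTo2From (h +ℤ stepVal s) ss

GoodWalk : ∀ n → Vec Step n → Set
GoodWalk n ss = PositiveWalkTo2From (+ 0) ss

module Submission where

-- Both families are counted by power series, and the bijection of the theorem
-- is the composite  {bracketings of value 1} ↔ Fin ωₙ = Fin (X₀)ₙ ↔ {walks}.
-- * SemiringIdentities (any commutative semiring): the equations
--   z = 1 + xzo, o = x(z² + oz + o²) of the series of bracketings of value 0
--   and 1 give t = z + o = 1 + xt², and o = xz²t implies z = 1 + x²z³t.  From
--   these relations alone we build X₀ = xz²t, X₁, X₂ and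
--   X_{h+3} = a X_{h+2} + b X_{h+1} (a = xzt, b = xz²), and check the
--   first-step recurrences of walks started at altitude h.
-- * Power series over ℕ form a commutative semiring; causal systems have
--   unique solutions.  This defines ζ, ω and proves ω = xζ²(ζ + ω).
-- * Counting: Fin ((A ⊛ B)ₙ) is a convolution of finite sets; splitting a
--   bracketing at its root matches the equations of ζ, ω (valued-count), and
--   splitting a walk at its first step matches those of the Xₕ (walk-count).

open import Data.Nat using (ℕ; zero; suc)
import Data.Nat as ℕ
open import Algebra.Bundles using (CommutativeSemiring)

module SemiringIdentities {c ℓ} (R : CommutativeSemiring c ℓ) where

  open CommutativeSemiring R
  open import Algebra.Solver.Ring.NaturalCoefficients.Default R
  open import Relation.Binary.Reasoning.Setoid setoid

  -- The equations satisfied by the generating functions z (bracketings of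
  -- value 0) and o (value 1), counted by their number of leaves minus one.
  module Bracketings (x z o : Carrier)
    (z-eq : z ≈ 1# + x * (z * o))
    (o-eq : o ≈ x * (z * z + o * z + o * o)) where

    t : Carrier
    t = z + o

    t-catalan : t ≈ 1# + x * (t * t)
    t-catalan = begin
      z + o
        ≈⟨ +-cong z-eq o-eq ⟩
      1# + x * (z * o) + x * (z * z + o * z + o * o)
        ≈⟨ solve 3 (λ x z o → con 1 :+ x :* (z :* o) :+ x :* (z :* z :+ o :* z :+ o :* o)
                          := con 1 :+ x :* ((z :+ o) :* (z :+ o))) refl x z o ⟩
      1# + x * (t * t) ∎

    -- o and x z² t both solve the linear equation A = x z² + x A t
    o-linear : o ≈ x * z * z + x * (o * t)
    o-linear = begin
      o
        ≈⟨ o-eq ⟩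
      x * (z * z + o * z + o * o)
        ≈⟨ solve 3 (λ x z o → x :* (z :* z :+ o :* z :+ o :* o)
                          := x :* z :* z :+ x :* (o :* (z :+ o))) refl x z o ⟩
      x * z * z + x * (o * t) ∎

    candidate-linear : x * z * z * t ≈ x * z * z + x * ((x * z * z * t) * t)
    candidate-linear = begin
      x * z * z * t
        ≈⟨ *-congˡ t-catalan ⟩
      x * z * z * (1# + x * (t * t))
        ≈⟨ solve 3 (λ x z t → x :* z :* z :* (con 1 :+ x :* (t :* t))
                          := x :* z :* z :+ x :* ((x :* z :* z :* t) :* t)) refl x z t ⟩
      x * z * z + x * ((x * z * z * t) * t) ∎

    module ClosedForm (o-closed : o ≈ x * z * z * t) where

      t-split : t ≈ z + x * z * z * t
      t-split = +-congˡ o-closed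

      z-closed : z ≈ 1# + x * x * z * z * z * t
      z-closed = begin
        z
          ≈⟨ z-eq ⟩
        1# + x * (z * o)
          ≈⟨ +-congˡ (*-congˡ (*-congˡ o-closed)) ⟩
        1# + x * (z * (x * z * z * t))
          ≈⟨ solve 3 (λ x z t → con 1 :+ x :* (z :* (x :* z :* z :* t))
                            := con 1 :+ x :* x :* z :* z :* z :* t) refl x z t ⟩
        1# + x * x * z * z * z * t ∎

      o-walk : o ≈ x * z * t * z
      o-walk = begin
        o
          ≈⟨ o-closed ⟩
        x * z * z * t
          ≈⟨ solve 3 (λ x z t → x :* z :* z :* t := x :* z :* t :* z) refl x z t ⟩
        x * z * t * z ∎

  module WalkSeries (x z t : Carrier)
    (t-catalan : t ≈ 1# + x * (t * t))
    (t-split   : t ≈ z + x * z * z * t)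
    (z-closed  : z ≈ 1# + x * x * z * z * z * t) where

    a b w : Carrier
    a = x * z * t
    b = x * z * z
    w = z * z

    z-ab : z ≈ 1# + a * b
    z-ab = begin
      z
        ≈⟨ z-closed ⟩
      1# + x * x * z * z * z * t
        ≈⟨ solve 3 (λ x z t → con 1 :+ x :* x :* z :* z :* z :* t
                          := con 1 :+ (x :* z :* t) :* (x :* z :* z)) refl x z t ⟩
      1# + a * b ∎

    az-ab : a * z ≈ a * a + b
    az-ab = begin
      a * z
        ≈⟨ solve 3 (λ x z t → (x :* z :* t) :* z := x :* z :* z :* t) refl x z t ⟩
      x * z * z * t
        ≈⟨ *-congˡ t-catalan ⟩
      x * z * z * (1# + x * (t * t))
        ≈⟨ solve 3 (λ x z t → x :* z :* z :* (con 1 :+ x :* (t :* t))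
                          := (x :* z :* t) :* (x :* z :* t) :+ x :* z :* z) refl x z t ⟩
      a * a + b ∎

    a-ab : a ≈ b + b * a
    a-ab = begin
      x * z * t
        ≈⟨ *-congˡ t-split ⟩
      x * z * (z + x * z * z * t)
        ≈⟨ solve 3 (λ x z t → x :* z :* (z :+ x :* z :* z :* t)
                          := x :* z :* z :+ (x :* z :* z) :* (x :* z :* t)) refl x z t ⟩
      b + b * a ∎

    t-az : t ≈ z + a * z
    t-az = begin
      t
        ≈⟨ t-split ⟩
      z + x * z * z * t
        ≈⟨ solve 3 (λ x z t → z :+ x :* z :* z :* t := z :+ (x :* z :* t) :* z) refl x z t ⟩
      z + a * z ∎

    -- a and b are algebraic over x; these two equations drive the
    -- recurrence of the walk series at altitudes ≥ 3
    a-eq : a ≈ x * (1# + a * b + (a * a + b) * (1# + a))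
    a-eq = begin
      x * z * t
        ≈⟨ *-congˡ t-catalan ⟩
      x * z * (1# + x * (t * t))
        ≈⟨ solve 3 (λ x z t → x :* z :* (con 1 :+ x :* (t :* t))
                          := x :* (z :+ (x :* z :* t) :* t)) refl x z t ⟩
      x * (z + a * t)
        ≈⟨ *-congˡ (+-congˡ (*-congˡ t-az)) ⟩
      x * (z + a * (z + a * z))
        ≈⟨ solve 3 (λ x a z → x :* (z :+ a :* (z :+ a :* z))
                          := x :* (z :+ a :* z :* (con 1 :+ a))) refl x a z ⟩
      x * (z + a * z * (1# + a))
        ≈⟨ *-congˡ (+-cong z-ab (*-congʳ az-ab)) ⟩
      x * (1# + a * b + (a * a + b) * (1# + a)) ∎

    b-eq : b ≈ x * (1# + a * b + (a * a + b) * b)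
    b-eq = begin
      x * z * z
        ≈⟨ *-congˡ z-ab ⟩
      x * z * (1# + a * b)
        ≈⟨ solve 3 (λ x z t → x :* z :* (con 1 :+ (x :* z :* t) :* (x :* z :* z))
                          := x :* (z :+ (x :* z :* t) :* z :* (x :* z :* z))) refl x z t ⟩
      x * (z + a * z * b)
        ≈⟨ *-congˡ (+-cong z-ab (*-congʳ az-ab)) ⟩
      x * (1# + a * b + (a * a + b) * b) ∎

    -- the walk series, indexed by the starting altitude
    X : ℕ → Carrier
    X 0                   = a * z
    X 1                   = a * w
    X 2                   = (1# + a * a) * w
    X (suc (suc (suc h))) = a * X (suc (suc h)) + b * X (suc h)

    -- first-step recurrences: from altitude h one may move to h−2, h−1,
    -- h+1, h+2 provided the new altitude is positive; only at altitude 2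
    -- may the walk also stop
    X-from-0 : X 0 ≈ x * (X 1 + X 2)
    X-from-0 = begin
      a * z
        ≈⟨ az-ab ⟩
      a * a + b
        ≈⟨ +-congʳ (*-congˡ a-ab) ⟩
      a * (b + b * a) + b
        ≈⟨ solve 3 (λ x z t → (x :* z :* t) :* (x :* z :* z :+ (x :* z :* z) :* (x :* z :* t)) :+ x :* z :* z
                          := x :* ((x :* z :* t) :* (z :* z) :+ (con 1 :+ (x :* z :* t) :* (x :* z :* t)) :* (z :* z)))
                   refl x z t ⟩
      x * (X 1 + X 2) ∎

    X-from-1 : X 1 ≈ x * (X 2 + X 3)
    X-from-1 = begin
      a * w
        ≈⟨ *-congʳ a-eq ⟩
      x * (1# + a * b + (a * a + b) * (1# + a)) * w
        ≈⟨ solve 4 (λ x a b w → x :* (con 1 :+ a :* b :+ (a :* a :+ b) :* (con 1 :+ a)) :* w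
                          := x :* ((b :+ b :* a) :+ (con 1 :+ a :* a :+ a :* a :* a :+ a :* b)) :* w) refl x a b w ⟩
      x * ((b + b * a) + (1# + a * a + a * a * a + a * b)) * w
        ≈⟨ *-congʳ (*-congˡ (+-congʳ (sym a-ab))) ⟩
      x * (a + (1# + a * a + a * a * a + a * b)) * w
        ≈⟨ solve 4 (λ x a b w → x :* (a :+ (con 1 :+ a :* a :+ a :* a :* a :+ a :* b)) :* w
                          := x :* ((con 1 :+ a :* a) :* w :+ (a :* ((con 1 :+ a :* a) :* w) :+ b :* (a :* w))))
                   refl x a b w ⟩
      x * (X 2 + X 3) ∎

    -- the constant term of the altitude-2 recurrence, expressed by X₁, X₂
    w-eq : w ≈ 1# + x * (X 1 + b * X 1 + b * X 2)
    w-eq = begin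
      z * z
        ≈⟨ *-cong z-ab z-ab ⟩
      (1# + a * b) * (1# + a * b)
        ≈⟨ solve 2 (λ a b → (con 1 :+ a :* b) :* (con 1 :+ a :* b)
                        := con 1 :+ a :* b :* (con 1 :+ a :* b) :+ a :* b) refl a b ⟩
      1# + a * b * (1# + a * b) + a * b
        ≈⟨ +-congˡ (*-congʳ a-ab) ⟩
      1# + a * b * (1# + a * b) + (b + b * a) * b
        ≈⟨ solve 3 (λ x z t → con 1 :+ (x :* z :* t) :* (x :* z :* z) :* (con 1 :+ (x :* z :* t) :* (x :* z :* z))
                                :+ (x :* z :* z :+ (x :* z :* z) :* (x :* z :* t)) :* (x :* z :* z)
                          := con 1 :+ x :* ((x :* z :* t) :* (z :* z) :+ (x :* z :* z) :* ((x :* z :* t) :* (z :* z))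
                                            :+ (x :* z :* z) :* ((con 1 :+ (x :* z :* t) :* (x :* z :* t)) :* (z :* z))))
                   refl x z t ⟩
      1# + x * (X 1 + b * X 1 + b * X 2) ∎

    X-from-2 : X 2 ≈ 1# + x * (X 1 + (X 3 + X 4))
    X-from-2 = begin
      (1# + a * a) * w
        ≈⟨ solve 2 (λ a w → (con 1 :+ a :* a) :* w := a :* (a :* w) :+ w) refl a w ⟩
      a * X 1 + w
        ≈⟨ +-cong (*-congˡ X-from-1) w-eq ⟩
      a * (x * (X 2 + X 3)) + (1# + x * (X 1 + b * X 1 + b * X 2))
        ≈⟨ solve 5 (λ x a b u v → a :* (x :* (v :+ (a :* v :+ b :* u))) :+ (con 1 :+ x :* (u :+ b :* u :+ b :* v))
                          := con 1 :+ x :* (u :+ ((a :* v :+ b :* u) :+ (a :* (a :* v :+ b :* u) :+ b :* v))))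
                   refl x a b (X 1) (X 2) ⟩
      1# + x * (X 1 + (X 3 + X 4)) ∎

    -- at altitude h + 3 all four steps are allowed; the recurrence
    -- X_{h+3} = a X_{h+2} + b X_{h+1} reduces this to a-eq and b-eq
    X-from-high : ∀ h → X (3 ℕ.+ h) ≈ x * (X (1 ℕ.+ h) + (X (2 ℕ.+ h) + (X (4 ℕ.+ h) + X (5 ℕ.+ h))))
    X-from-high h = begin
      a * v + b * u
        ≈⟨ +-cong (*-congʳ a-eq) (*-congʳ b-eq) ⟩
      x * (1# + a * b + (a * a + b) * (1# + a)) * v + x * (1# + a * b + (a * a + b) * b) * u
        ≈⟨ solve 5 (λ x a b u v → x :* (con 1 :+ a :* b :+ (a :* a :+ b) :* (con 1 :+ a)) :* v
                                  :+ x :* (con 1 :+ a :* b :+ (a :* a :+ b) :* b) :* u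
                          := x :* (u :+ (v :+ ((a :* (a :* v :+ b :* u) :+ b :* v)
                                  :+ (a :* (a :* (a :* v :+ b :* u) :+ b :* v) :+ b :* (a :* v :+ b :* u))))))
                   refl x a b u v ⟩
      x * (X (1 ℕ.+ h) + (X (2 ℕ.+ h) + (X (4 ℕ.+ h) + X (5 ℕ.+ h)))) ∎
      where
      u v : Carrier
      u = X (1 ℕ.+ h)
      v = X (2 ℕ.+ h)

open import Defs
open import Data.Nat using (_+_; _*_; _≤_; _<_; z≤n; s≤s; z<s)
open import Data.Nat.Properties
  using ( +-assoc; +-comm; +-identityʳ; *-identityˡ; *-assoc; *-comm; *-distribˡ-+; *-distribʳ-+; +-commutativeSemigroup
        ; ≤-refl; <-≤-trans; m<n⇒m<1+n; m<1+n⇒m≤n; m<1+n⇒m<n∨m≡n; m≤m+n; m≤n+m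
        ; +-suc; suc-injective; 1+n≢0; ≡-irrelevant )
open import Data.Nat.Induction using (<-rec)
open import Data.Integer using (ℤ; +_; -[1+_]; +<+) renaming (_+_ to _+ℤ_; _<_ to _<ℤ_)
open import Data.Integer.Properties using (<-irrelevant)
open import Data.Bool using (Bool; true; false)
open import Data.Empty using (⊥; ⊥-elim)
open import Data.Unit using (tt)
open import Data.Fin using (Fin)
open import Data.Fin.Properties using (+↔⊎; *↔×; 1↔⊤)
open import Data.Vec using (Vec; []; _∷_)
open import Data.Product using (Σ; _×_; _,_; proj₁; proj₂)
open import Data.Sum using (_⊎_; inj₁; inj₂)
open import Relation.Nullary using (¬_)
open import Relation.Binary.PropositionalEquality using (_≡_; refl; sym; trans; cong; cong₂; subst; module ≡-Reasoning)
open import Relation.Binary.Structures using (IsEquivalence)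
open import Algebra.Structures.Biased using (IsCommutativeSemiringˡ)
open import Algebra.Properties.CommutativeSemigroup +-commutativeSemigroup using (interchange)
open import Function.Bundles using (_↔_; mk↔ₛ′)
open import Function.Properties.Inverse using (↔-refl; ↔-sym; ↔-trans)
open import Function.Related.Propositional using (module EquationalReasoning)
open import Function.Related.TypeIsomorphisms using (Σ-assoc; Σ-distribˡ-⊎)
open import Data.Sum.Function.Propositional using (_⊎-↔_)
open import Data.Product.Function.NonDependent.Propositional using (_×-↔_)
open import Data.Product.Function.Dependent.Propositional using (Σ-↔)

Series : Set
Series = ℕ → ℕ

infix  4 _≈ₛ_
infixl 6 _⊕_
infixl 7 _⊛_

_≈ₛ_ : Series → Series → Set
A ≈ₛ B = ∀ n → A n ≡ B n

tail : Series → Series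
tail A n = A (suc n)

_⊕_ : Series → Series → Series
(A ⊕ B) n = A n + B n

_⊛_ : Series → Series → Series
(A ⊛ B) zero    = A 0 * B 0
(A ⊛ B) (suc n) = A 0 * B (suc n) + (tail A ⊛ B) n

_·ₛ_ : ℕ → Series → Series
(c ·ₛ B) n = c * B n

0ₛ 1ₛ xₛ : Series
0ₛ _ = 0
1ₛ zero    = 1
1ₛ (suc _) = 0
xₛ zero          = 0
xₛ (suc zero)    = 1
xₛ (suc (suc _)) = 0

⊛-cong : ∀ {A A′ B B′} → A ≈ₛ A′ → B ≈ₛ B′ → A ⊛ B ≈ₛ A′ ⊛ B′
⊛-cong p q zero    = cong₂ _*_ (p 0) (q 0)
⊛-cong p q (suc n) = cong₂ _+_ (cong₂ _*_ (p 0) (q (suc n))) (⊛-cong (λ m → p (suc m)) q n)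

⊛-vanishˡ : ∀ {A} B → A ≈ₛ 0ₛ → A ⊛ B ≈ₛ 0ₛ
⊛-vanishˡ B p zero    = cong (_* B 0) (p 0)
⊛-vanishˡ B p (suc n) = cong₂ _+_ (cong (_* B (suc n)) (p 0)) (⊛-vanishˡ B (λ m → p (suc m)) n)

⊛-identityˡ : ∀ B → 1ₛ ⊛ B ≈ₛ B
⊛-identityˡ B zero    = +-identityʳ (B 0)
⊛-identityˡ B (suc n) = begin
  1 * B (suc n) + (tail 1ₛ ⊛ B) n ≡⟨ cong₂ _+_ (*-identityˡ (B (suc n))) (⊛-vanishˡ B (λ _ → refl) n) ⟩
  B (suc n) + 0                   ≡⟨ +-identityʳ (B (suc n)) ⟩
  B (suc n)                       ∎
  where open ≡-Reasoning

⊛-distribʳ : ∀ C A B → (A ⊕ B) ⊛ C ≈ₛ A ⊛ C ⊕ B ⊛ C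
⊛-distribʳ C A B zero    = *-distribʳ-+ (C 0) (A 0) (B 0)
⊛-distribʳ C A B (suc n) = begin
  (A 0 + B 0) * C (suc n) + ((tail A ⊕ tail B) ⊛ C) n
    ≡⟨ cong₂ _+_ (*-distribʳ-+ (C (suc n)) (A 0) (B 0)) (⊛-distribʳ C (tail A) (tail B) n) ⟩
  (A 0 * C (suc n) + B 0 * C (suc n)) + ((tail A ⊛ C) n + (tail B ⊛ C) n)
    ≡⟨ interchange (A 0 * C (suc n)) (B 0 * C (suc n)) _ _ ⟩
  (A 0 * C (suc n) + (tail A ⊛ C) n) + (B 0 * C (suc n) + (tail B ⊛ C) n) ∎
  where open ≡-Reasoning

⊛-scaleˡ : ∀ c B C → (c ·ₛ B) ⊛ C ≈ₛ c ·ₛ (B ⊛ C)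
⊛-scaleˡ c B C zero    = *-assoc c (B 0) (C 0)
⊛-scaleˡ c B C (suc n) = begin
  c * B 0 * C (suc n) + ((c ·ₛ tail B) ⊛ C) n
    ≡⟨ cong₂ _+_ (*-assoc c (B 0) (C (suc n))) (⊛-scaleˡ c (tail B) C n) ⟩
  c * (B 0 * C (suc n)) + c * (tail B ⊛ C) n
    ≡⟨ *-distribˡ-+ c (B 0 * C (suc n)) _ ⟨
  c * (B 0 * C (suc n) + (tail B ⊛ C) n) ∎
  where open ≡-Reasoning

-- uses that tail (A ⊛ B) = A₀ · tail B ⊕ tail A ⊛ B holds by definition
⊛-assoc : ∀ A B C → (A ⊛ B) ⊛ C ≈ₛ A ⊛ (B ⊛ C)
⊛-assoc A B C zero    = *-assoc (A 0) (B 0) (C 0)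
⊛-assoc A B C (suc n) = begin
  A 0 * B 0 * C (suc n) + ((A 0 ·ₛ tail B ⊕ tail A ⊛ B) ⊛ C) n
    ≡⟨ cong₂ _+_ (*-assoc (A 0) (B 0) (C (suc n))) (⊛-distribʳ C (A 0 ·ₛ tail B) (tail A ⊛ B) n) ⟩
  A 0 * (B 0 * C (suc n)) + (((A 0 ·ₛ tail B) ⊛ C) n + ((tail A ⊛ B) ⊛ C) n)
    ≡⟨ cong (λ m → A 0 * (B 0 * C (suc n)) + m) (cong₂ _+_ (⊛-scaleˡ (A 0) (tail B) C n) (⊛-assoc (tail A) B C n)) ⟩
  A 0 * (B 0 * C (suc n)) + (A 0 * (tail B ⊛ C) n + (tail A ⊛ (B ⊛ C)) n)
    ≡⟨ +-assoc (A 0 * (B 0 * C (suc n))) _ _ ⟨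
  A 0 * (B 0 * C (suc n)) + A 0 * (tail B ⊛ C) n + (tail A ⊛ (B ⊛ C)) n
    ≡⟨ cong (_+ (tail A ⊛ (B ⊛ C)) n) (*-distribˡ-+ (A 0) (B 0 * C (suc n)) _) ⟨
  A 0 * (B ⊛ C) (suc n) + (tail A ⊛ (B ⊛ C)) n ∎
  where open ≡-Reasoning

-- peeling the first coefficient off both factors in turn
⊛-comm : ∀ A B → A ⊛ B ≈ₛ B ⊛ A
⊛-comm A B zero             = *-comm (A 0) (B 0)
⊛-comm A B (suc zero)       = begin
  A 0 * B 1 + A 1 * B 0 ≡⟨ +-comm (A 0 * B 1) (A 1 * B 0) ⟩
  A 1 * B 0 + A 0 * B 1 ≡⟨ cong₂ _+_ (*-comm (A 1) (B 0)) (*-comm (A 0) (B 1)) ⟩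
  B 0 * A 1 + B 1 * A 0 ∎
  where open ≡-Reasoning
⊛-comm A B (suc (suc n)) = begin
  A 0 * B (2 + n) + (tail A ⊛ B) (suc n)
    ≡⟨ cong (λ m → A 0 * B (2 + n) + m) (⊛-comm (tail A) B (suc n)) ⟩
  A 0 * B (2 + n) + (B 0 * A (2 + n) + (tail B ⊛ tail A) n)
    ≡⟨ +-assoc (A 0 * B (2 + n)) _ _ ⟨
  A 0 * B (2 + n) + B 0 * A (2 + n) + (tail B ⊛ tail A) n
    ≡⟨ cong₂ _+_ (+-comm (A 0 * B (2 + n)) _) (⊛-comm (tail B) (tail A) n) ⟩
  B 0 * A (2 + n) + A 0 * B (2 + n) + (tail A ⊛ tail B) n
    ≡⟨ +-assoc (B 0 * A (2 + n)) _ _ ⟩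
  B 0 * A (2 + n) + (A 0 * B (2 + n) + (tail A ⊛ tail B) n)
    ≡⟨ cong (λ m → B 0 * A (2 + n) + m) (⊛-comm (tail B) A (suc n)) ⟨
  B 0 * A (2 + n) + (tail B ⊛ A) (suc n) ∎
  where open ≡-Reasoning

seriesSemiring : CommutativeSemiring _ _
seriesSemiring = record { isCommutativeSemiring = IsCommutativeSemiringˡ.isCommutativeSemiring record
  { +-isCommutativeMonoid = record
    { isMonoid = record
      { isSemigroup = record
        { isMagma = record { isEquivalence = ≈ₛ-isEquivalence ; ∙-cong = λ p q n → cong₂ _+_ (p n) (q n) }
        ; assoc   = λ A B C n → +-assoc (A n) (B n) (C n) }
      ; identity = (λ A n → refl) , (λ A n → +-identityʳ (A n)) }
    ; comm = λ A B n → +-comm (A n) (B n) }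
  ; *-isCommutativeMonoid = record
    { isMonoid = record
      { isSemigroup = record
        { isMagma = record { isEquivalence = ≈ₛ-isEquivalence ; ∙-cong = ⊛-cong }
        ; assoc   = ⊛-assoc }
      ; identity = ⊛-identityˡ , (λ A n → trans (⊛-comm A 1ₛ n) (⊛-identityˡ A n)) }
    ; comm = ⊛-comm }
  ; distribʳ = ⊛-distribʳ
  ; zeroˡ    = λ B → ⊛-vanishˡ B (λ _ → refl) } }
  where
  ≈ₛ-isEquivalence : IsEquivalence _≈ₛ_
  ≈ₛ-isEquivalence = record { refl = λ _ → refl ; sym = λ p n → sym (p n) ; trans = λ p q n → trans (p n) (q n) }

shift-suc : ∀ A n → (xₛ ⊛ A) (suc n) ≡ A n
shift-suc A n = trans (⊛-cong tail-xₛ (λ _ → refl) n) (⊛-identityˡ A n)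
  where
  tail-xₛ : tail xₛ ≈ₛ 1ₛ
  tail-xₛ zero    = refl
  tail-xₛ (suc _) = refl

module Causality {S : Set} where

  Below : ℕ → (ℕ → S) → (ℕ → S) → Set
  Below n F G = ∀ j → j < n → F j ≡ G j

  Causal : ((ℕ → S) → ℕ → S) → Set
  Causal Φ = ∀ n {F G} → Below n F G → Φ F n ≡ Φ G n

  IsFixedPoint : ((ℕ → S) → ℕ → S) → (ℕ → S) → Set
  IsFixedPoint Φ F = ∀ n → F n ≡ Φ F n

  below-suc : ∀ {n F G} → Below n F G → F n ≡ G n → Below (suc n) F G
  below-suc {n} p q j j<1+n with m<1+n⇒m<n∨m≡n j<1+n
  ... | inj₁ j<n  = p j j<n
  ... | inj₂ refl = q

  causal-unique : ∀ {Φ F G} → Causal Φ → IsFixedPoint Φ F → IsFixedPoint Φ G → ∀ n → F n ≡ G n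
  causal-unique {Φ} {F} {G} causal fixF fixG n = agree (suc n) n ≤-refl
    where
    agree : ∀ m → Below m F G
    agree zero    _ ()
    agree (suc m) = below-suc (agree m) (trans (fixF m) (trans (causal m (agree m)) (sym (fixG m))))

  -- The fixed point is the diagonal of the iterates Φᵏ(const s₀): the k-th
  -- iterate is already correct below index k.
  causal-fixpoint : ∀ {Φ} → S → Causal Φ → Σ (ℕ → S) (IsFixedPoint Φ)
  causal-fixpoint {Φ} s₀ causal = limit , λ n → causal n (limit-agrees n)
    where
    approx : ℕ → ℕ → S
    approx zero    _ = s₀
    approx (suc k)   = Φ (approx k)

    approx-stable : ∀ k → Below k (approx k) (approx (suc k))
    approx-stable zero    _ ()
    approx-stable (suc k) j j<1+k =
      causal j (λ i i<j → approx-stable k i (<-≤-trans i<j (m<1+n⇒m≤n j<1+k)))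

    limit : ℕ → S
    limit n = approx (suc n) n

    limit-agrees : ∀ m → Below m (approx m) limit
    limit-agrees zero    _ ()
    limit-agrees (suc m) j j<1+m with m<1+n⇒m<n∨m≡n j<1+m
    ... | inj₁ j<m  = trans (sym (approx-stable m j j<m)) (limit-agrees m j j<m)
    ... | inj₂ refl = refl

open Causality

⊕-below : ∀ {n A A′ B B′} → Below n A A′ → Below n B B′ → Below n (A ⊕ B) (A′ ⊕ B′)
⊕-below p q j j<n = cong₂ _+_ (p j j<n) (q j j<n)

⊛-below : ∀ n {A A′ B B′} → Below n A A′ → Below n B B′ → Below n (A ⊛ B) (A′ ⊛ B′)
⊛-below (suc n) p q zero    _            = cong₂ _*_ (p 0 z<s) (q 0 z<s)
⊛-below (suc n) p q (suc j) (s≤s j<n) =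
  cong₂ _+_ (cong₂ _*_ (p 0 z<s) (q (suc j) (s≤s j<n)))
            (⊛-below n (λ i i<n → p (suc i) (s≤s i<n)) (λ i i<n → q i (m<n⇒m<1+n i<n)) j j<n)

shift-below : ∀ {n A B} → Below n A B → Below (suc n) (xₛ ⊛ A) (xₛ ⊛ B)
shift-below p zero    _          = refl
shift-below {A = A} {B} p (suc j) (s≤s j<n) = trans (shift-suc A j) (trans (p j j<n) (sym (shift-suc B j)))

linear-unique : ∀ {A B} C D → A ≈ₛ C ⊕ xₛ ⊛ (A ⊛ D) → B ≈ₛ C ⊕ xₛ ⊛ (B ⊛ D) → A ≈ₛ B
linear-unique C D = causal-unique causal
  where
  causal : Causal (λ A → C ⊕ xₛ ⊛ (A ⊛ D))
  causal n p = cong (λ m → C n + m) (shift-below (⊛-below n p (λ _ _ → refl)) n ≤-refl)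

Fin-cong : ∀ {m n} → m ≡ n → Fin m ↔ Fin n
Fin-cong refl = ↔-refl

Fin-+₄ : ∀ {a b c d} → Fin (a + (b + (c + d))) ↔ (Fin a ⊎ (Fin b ⊎ (Fin c ⊎ Fin d)))
Fin-+₄ = ↔-trans +↔⊎ (↔-refl ⊎-↔ ↔-trans +↔⊎ (↔-refl ⊎-↔ +↔⊎))

empty↔Fin0 : ∀ {A : Set} → ¬ A → A ↔ Fin 0
empty↔Fin0 ¬a = mk↔ₛ′ (λ a → ⊥-elim (¬a a)) (λ ()) (λ ()) (λ a → ⊥-elim (¬a a))

Split : ℕ → Set
Split n = Σ ℕ (λ i → Σ ℕ (λ j → i + j ≡ n))

Convolution : (ℕ → Set) → (ℕ → Set) → ℕ → Set
Convolution P Q n = Σ (Split n) (λ s → P (proj₁ s) × Q (proj₁ (proj₂ s)))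

convolution-zero : ∀ {P Q : ℕ → Set} → (P 0 × Q 0) ↔ Convolution P Q 0
convolution-zero {P} {Q} = mk↔ₛ′ (λ pq → (0 , 0 , refl) , pq) from (λ { ((0 , 0 , refl) , _) → refl }) (λ _ → refl)
  where
  from : Convolution P Q 0 → P 0 × Q 0
  from ((0 , 0 , refl) , pq) = pq

convolution-suc : ∀ {P Q : ℕ → Set} n → (P 0 × Q (suc n) ⊎ Convolution (λ i → P (suc i)) Q n) ↔ Convolution P Q (suc n)
convolution-suc {P} {Q} n = mk↔ₛ′ to from to-from from-to
  where
  to : ∀ {m} → P 0 × Q (suc m) ⊎ Convolution (λ i → P (suc i)) Q m → Convolution P Q (suc m)
  to (inj₁ pq)                = (0 , _ , refl) , pq
  to (inj₂ ((i , j , e) , pq)) = (suc i , j , cong suc e) , pq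
  from : ∀ {m} → Convolution P Q (suc m) → P 0 × Q (suc m) ⊎ Convolution (λ i → P (suc i)) Q m
  from ((0 , j , refl) , pq)     = inj₁ pq
  from ((suc i , j , refl) , pq) = inj₂ ((i , j , refl) , pq)
  to-from : ∀ {m} (c : Convolution P Q (suc m)) → to (from c) ≡ c
  to-from ((0 , j , refl) , pq)     = refl
  to-from ((suc i , j , refl) , pq) = refl
  from-to : ∀ {m} (c : P 0 × Q (suc m) ⊎ Convolution (λ i → P (suc i)) Q m) → from (to c) ≡ c
  from-to (inj₁ pq)                   = refl
  from-to (inj₂ ((i , j , refl) , pq)) = refl

Fin-⊛ : ∀ A B n → Fin ((A ⊛ B) n) ↔ Convolution (λ i → Fin (A i)) (λ j → Fin (B j)) n
Fin-⊛ A B zero    = ↔-trans *↔× convolution-zero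
Fin-⊛ A B (suc n) = ↔-trans +↔⊎ (↔-trans (*↔× ⊎-↔ Fin-⊛ (tail A) B n) (convolution-suc n))

Σ-split-cong : ∀ n {F G : ℕ → ℕ → Set} → (∀ i j → i ≤ n → j ≤ n → F i j ↔ G i j) →
  Σ (Split n) (λ s → F (proj₁ s) (proj₁ (proj₂ s))) ↔ Σ (Split n) (λ s → G (proj₁ s) (proj₁ (proj₂ s)))
Σ-split-cong n F↔G = Σ-↔ ↔-refl (λ { {i , j , refl} → F↔G i j (m≤m+n i j) (m≤n+m j i) })

fibres : ∀ {L : Set} (f : L → Bool) → L ↔ Σ Bool (λ v → Σ L (λ l → f l ≡ v))
fibres f = mk↔ₛ′ (λ l → f l , l , refl) (λ { (_ , l , _) → l }) (λ { (_ , _ , refl) → refl }) (λ _ → refl)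

≡-ends : ∀ {a b v : Bool} → a ≡ b → (a ≡ v) ↔ (b ≡ v)
≡-ends refl = ↔-refl

PowFibre : Bool → (Bool → Set) → (Bool → Set) → Set
PowFibre false P Q = P false × Q true
PowFibre true  P Q = (P false × Q false ⊎ P true × Q false) ⊎ P true × Q true

pow-fibre : ∀ v (P Q : Bool → Set) →
  Σ (Σ Bool P × Σ Bool Q) (λ pq → pow (proj₁ (proj₁ pq)) (proj₁ (proj₂ pq)) ≡ v) ↔ PowFibre v P Q
pow-fibre false P Q = mk↔ₛ′ to from (λ _ → refl) from-to
  where
  to : Σ (Σ Bool P × Σ Bool Q) (λ pq → pow (proj₁ (proj₁ pq)) (proj₁ (proj₂ pq)) ≡ false) → PowFibre false P Q
  to (((false , l) , (true , r)) , refl) = l , r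
  from : PowFibre false P Q → Σ (Σ Bool P × Σ Bool Q) (λ pq → pow (proj₁ (proj₁ pq)) (proj₁ (proj₂ pq)) ≡ false)
  from (l , r) = ((false , l) , (true , r)) , refl
  from-to : ∀ c → from (to c) ≡ c
  from-to (((false , l) , (true , r)) , refl) = refl
pow-fibre true P Q = mk↔ₛ′ to from to-from from-to
  where
  to : Σ (Σ Bool P × Σ Bool Q) (λ pq → pow (proj₁ (proj₁ pq)) (proj₁ (proj₂ pq)) ≡ true) → PowFibre true P Q
  to (((false , l) , (false , r)) , refl) = inj₁ (inj₁ (l , r))
  to (((true  , l) , (false , r)) , refl) = inj₁ (inj₂ (l , r))
  to (((true  , l) , (true  , r)) , refl) = inj₂ (l , r)
  from : PowFibre true P Q → Σ (Σ Bool P × Σ Bool Q) (λ pq → pow (proj₁ (proj₁ pq)) (proj₁ (proj₂ pq)) ≡ true)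
  from (inj₁ (inj₁ (l , r))) = ((false , l) , (false , r)) , refl
  from (inj₁ (inj₂ (l , r))) = ((true  , l) , (false , r)) , refl
  from (inj₂ (l , r))        = ((true  , l) , (true  , r)) , refl
  to-from : ∀ c → to (from c) ≡ c
  to-from (inj₁ (inj₁ _)) = refl
  to-from (inj₁ (inj₂ _)) = refl
  to-from (inj₂ _)        = refl
  from-to : ∀ c → from (to c) ≡ c
  from-to (((false , l) , (false , r)) , refl) = refl
  from-to (((true  , l) , (false , r)) , refl) = refl
  from-to (((true  , l) , (true  , r)) , refl) = refl

PowFibre-cong : ∀ v {P P′ Q Q′ : Bool → Set} → (∀ p → P p ↔ P′ p) → (∀ q → Q q ↔ Q′ q) → PowFibre v P Q ↔ PowFibre v P′ Q′
PowFibre-cong false P↔P′ Q↔Q′ = P↔P′ false ×-↔ Q↔Q′ true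
PowFibre-cong true  P↔P′ Q↔Q′ =
  ((P↔P′ false ×-↔ Q↔Q′ false) ⊎-↔ (P↔P′ true ×-↔ Q↔Q′ false)) ⊎-↔ (P↔P′ true ×-↔ Q↔Q′ true)

Valued : Bool → ℕ → Set
Valued v n = Σ (Bracketing (suc n)) (λ t → value t ≡ v)

leaf-only : ∀ {k} (t : Bracketing k) (e : k ≡ 1) → subst Bracketing e t ≡ leaf
leaf-only leaf               e = cong (λ e → subst Bracketing e leaf) (≡-irrelevant e refl)
leaf-only (node {i} {j} l r) e = ⊥-elim (1+n≢0 (trans (sym (+-suc i j)) (suc-injective e)))

Subtrees : ℕ → Set
Subtrees = Convolution (λ i → Bracketing (suc i)) (λ j → Bracketing (suc j))

node-size : ∀ {i j n} → i + j ≡ n → suc i + suc j ≡ suc (suc n)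
node-size {i} {j} e = cong suc (trans (+-suc i j) (cong suc e))

node-size⁻¹ : ∀ {i j n} → suc i + suc j ≡ suc (suc n) → i + j ≡ n
node-size⁻¹ {i} {j} e = suc-injective (trans (sym (+-suc i j)) (suc-injective e))

subtrees : ∀ {k n} → Bracketing k → k ≡ suc (suc n) → Subtrees n
subtrees (node {i} {j} l r) e = (i , j , node-size⁻¹ e) , l , r

graft : ∀ {n} → Subtrees n → Bracketing (suc (suc n))
graft ((i , j , e) , l , r) = subst Bracketing (node-size e) (node l r)

subtrees-subst : ∀ {k k′ n} (e : k ≡ k′) (t : Bracketing k) (e′ : k′ ≡ suc (suc n)) →
  subtrees (subst Bracketing e t) e′ ≡ subtrees t (trans e e′)
subtrees-subst refl t e′ = refl

graft-subtrees : ∀ {k n} (t : Bracketing k) (e : k ≡ suc (suc n)) → graft (subtrees t e) ≡ subst Bracketing e t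
graft-subtrees (node l r) e = cong (λ e → subst Bracketing e (node l r)) (≡-irrelevant _ _)

nodes : ∀ {n} → Bracketing (suc (suc n)) ↔ Subtrees n
nodes = mk↔ₛ′ (λ t → subtrees t refl) graft subtrees-graft (λ t → graft-subtrees t refl)
  where
  subtrees-graft : ∀ {n} (s : Subtrees n) → subtrees (graft s) refl ≡ s
  subtrees-graft ((i , j , e) , l , r) =
    trans (subtrees-subst (node-size e) (node l r) refl) (cong (λ e → (i , j , e) , l , r) (≡-irrelevant _ _))

value-subtrees : ∀ {k n} (t : Bracketing k) (e : k ≡ suc (suc n)) →
  value t ≡ pow (value (proj₁ (proj₂ (subtrees t e)))) (value (proj₂ (proj₂ (subtrees t e))))
value-subtrees (node l r) e = refl

valued-split : ∀ v n →
  Valued v (suc n) ↔ Σ (Split n) (λ s → PowFibre v (λ p → Valued p (proj₁ s)) (λ q → Valued q (proj₁ (proj₂ s))))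
valued-split v n =
  ↔-trans (Σ-↔ nodes (λ {t} → ≡-ends (value-subtrees t refl)))
  (↔-trans Σ-assoc
  (Σ-↔ ↔-refl (↔-trans (Σ-↔ (fibres value ×-↔ fibres value) ↔-refl) (pow-fibre v _ _))))

-- The generating functions ζ and ω of bracketings of value 0 and of value 1
-- (coefficient n counts bracketings of n + 1 zeroes) are the unique solution of
--   ζ = 1 + x ζ ω,   ω = x (ζ² + ω ζ + ω²),
-- read off from the values of a ^ b; it exists since the system is causal.
zeroRule oneRule : Series → Series → Series
zeroRule Z O = 1ₛ ⊕ xₛ ⊛ (Z ⊛ O)
oneRule  Z O = xₛ ⊛ (Z ⊛ Z ⊕ O ⊛ Z ⊕ O ⊛ O)

zeros ones : (ℕ → ℕ × ℕ) → Series
zeros F n = proj₁ (F n)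
ones  F n = proj₂ (F n)

bracketingRule : (ℕ → ℕ × ℕ) → ℕ → ℕ × ℕ
bracketingRule F n = zeroRule (zeros F) (ones F) n , oneRule (zeros F) (ones F) n

bracketingRule-causal : Causal bracketingRule
bracketingRule-causal n {F} {G} p =
  cong₂ _,_ (cong (λ m → 1ₛ n + m) (shift-below (⊛-below n pZ pO) n ≤-refl))
            (shift-below (⊕-below (⊕-below (⊛-below n pZ pZ) (⊛-below n pO pZ)) (⊛-below n pO pO)) n ≤-refl)
  where
  pZ : Below n (zeros F) (zeros G)
  pZ j j<n = cong proj₁ (p j j<n)
  pO : Below n (ones F) (ones G)
  pO j j<n = cong proj₂ (p j j<n)

bracketingSeries : Σ (ℕ → ℕ × ℕ) (IsFixedPoint bracketingRule)
bracketingSeries = causal-fixpoint (0 , 0) bracketingRule-causal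

ζ ω : Series
ζ = zeros (proj₁ bracketingSeries)
ω = ones (proj₁ bracketingSeries)

ζ-eq : ζ ≈ₛ zeroRule ζ ω
ζ-eq n = cong proj₁ (proj₂ bracketingSeries n)

ω-eq : ω ≈ₛ oneRule ζ ω
ω-eq n = cong proj₂ (proj₂ bracketingSeries n)

count : Bool → Series
count false = ζ
count true  = ω

-- the coefficient recurrences, in the shape of valued-split
count-split : ∀ v n →
  Fin (count v (suc n)) ↔ Σ (Split n) (λ s → PowFibre v (λ p → Fin (count p (proj₁ s))) (λ q → Fin (count q (proj₁ (proj₂ s)))))
count-split false n = ↔-trans (Fin-cong (trans (ζ-eq (suc n)) (shift-suc (ζ ⊛ ω) n))) (Fin-⊛ ζ ω n)
count-split true  n =
  ↔-trans (Fin-cong (trans (ω-eq (suc n)) (shift-suc (ζ ⊛ ζ ⊕ ω ⊛ ζ ⊕ ω ⊛ ω) n)))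
  (↔-trans +↔⊎
  (↔-trans (+↔⊎ ⊎-↔ ↔-refl)
  (↔-trans ((Fin-⊛ ζ ζ n ⊎-↔ Fin-⊛ ω ζ n) ⊎-↔ Fin-⊛ ω ω n)
  (↔-trans (↔-sym Σ-distribˡ-⊎ ⊎-↔ ↔-refl) (↔-sym Σ-distribˡ-⊎)))))

valued-leaf : ∀ v → Valued v 0 ↔ Fin (count v 0)
valued-leaf false = ↔-trans (mk↔ₛ′ (λ _ → tt) (λ _ → leaf , refl) (λ _ → refl) only-leaf)
                            (↔-trans (↔-sym 1↔⊤) (Fin-cong (sym (ζ-eq 0))))
  where
  only-leaf : ∀ (t : Valued false 0) → (leaf , refl) ≡ t
  only-leaf (t , p) with leaf-only t refl
  only-leaf (.leaf , refl) | refl = refl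
valued-leaf true  = ↔-trans (empty↔Fin0 leaf-is-false) (Fin-cong (sym (ω-eq 0)))
  where
  leaf-is-false : ¬ Valued true 0
  leaf-is-false (t , p) with leaf-only t refl
  leaf-is-false (.leaf , ()) | refl

valued-count : ∀ n v → Valued v n ↔ Fin (count v n)
valued-count = <-rec _ step
  where
  step : ∀ n → (∀ {m} → m < n → ∀ v → Valued v m ↔ Fin (count v m)) → ∀ v → Valued v n ↔ Fin (count v n)
  step zero    _  v = valued-leaf v
  step (suc n) ih v =
    ↔-trans (valued-split v n)
    (↔-trans (Σ-split-cong n (λ i j i≤n j≤n → PowFibre-cong v (ih (s≤s i≤n)) (ih (s≤s j≤n))))
    (↔-sym (count-split v n)))

open SemiringIdentities seriesSemiring

τ : Series
τ = ζ ⊕ ω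

open Bracketings xₛ ζ ω ζ-eq ω-eq

-- ω = x ζ² τ, since both sides solve the same guarded linear equation
ω-closed : ω ≈ₛ xₛ ⊛ ζ ⊛ ζ ⊛ τ
ω-closed = linear-unique (xₛ ⊛ ζ ⊛ ζ) τ o-linear candidate-linear

open ClosedForm ω-closed
open WalkSeries xₛ ζ τ t-catalan t-split z-closed

Walks : ℕ → ℕ → Set
Walks h n = Σ (Vec Step n) (PositiveWalkTo2From (+ h))

Continuations : ℤ → ℕ → Set
Continuations q n = Σ (Vec Step n) (λ ss → (+ 0 <ℤ q) × PositiveWalkTo2From q ss)

walks-first-step : ∀ h n → Walks h (suc n) ↔ Σ Step (λ s → Continuations (+ h +ℤ stepVal s) n)
walks-first-step h n = mk↔ₛ′ (λ { (s ∷ ss , w) → s , ss , w }) (λ { (s , ss , w) → s ∷ ss , w })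
                             (λ _ → refl) (λ { (_ ∷ _ , _) → refl })

Landing : ℤ → ℕ → Set
Landing (+ suc h) n = Walks (suc h) n
Landing _         n = ⊥

landing : ∀ q n → Continuations q n ↔ Landing q n
landing (+ zero)  n = mk↔ₛ′ (λ { (_ , +<+ () , _) }) (λ ()) (λ ()) (λ { (_ , +<+ () , _) })
landing -[1+ _ ]  n = mk↔ₛ′ (λ { (_ , () , _) }) (λ ()) (λ ()) (λ { (_ , () , _) })
landing (+ suc h) n = mk↔ₛ′ (λ { (ss , _ , w) → ss , w }) (λ { (ss , w) → ss , +<+ (s≤s z≤n) , w }) (λ _ → refl)
                            (λ { (ss , p , w) → cong (λ p → ss , p , w) (<-irrelevant _ p) })

landingCount : ℤ → ℕ → ℕ
landingCount (+ suc h) n = X (suc h) n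
landingCount _         n = 0

landing-count : ∀ n → (∀ h → Walks h n ↔ Fin (X h n)) → ∀ q → Landing q n ↔ Fin (landingCount q n)
landing-count n ih (+ suc h) = ih (suc h)
landing-count n ih (+ zero)  = empty↔Fin0 (λ ())
landing-count n ih -[1+ _ ]  = empty↔Fin0 (λ ())

Σ-Step : ∀ (F : Step → Set) → Σ Step F ↔ (F m2 ⊎ (F m1 ⊎ (F p1 ⊎ F p2)))
Σ-Step F = mk↔ₛ′ to from to-from from-to
  where
  to : Σ Step F → F m2 ⊎ (F m1 ⊎ (F p1 ⊎ F p2))
  to (m2 , f) = inj₁ f
  to (m1 , f) = inj₂ (inj₁ f)
  to (p1 , f) = inj₂ (inj₂ (inj₁ f))
  to (p2 , f) = inj₂ (inj₂ (inj₂ f))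
  from : F m2 ⊎ (F m1 ⊎ (F p1 ⊎ F p2)) → Σ Step F
  from (inj₁ f)                = m2 , f
  from (inj₂ (inj₁ f))         = m1 , f
  from (inj₂ (inj₂ (inj₁ f))) = p1 , f
  from (inj₂ (inj₂ (inj₂ f))) = p2 , f
  to-from : ∀ c → to (from c) ≡ c
  to-from (inj₁ _)                = refl
  to-from (inj₂ (inj₁ _))         = refl
  to-from (inj₂ (inj₂ (inj₁ _))) = refl
  to-from (inj₂ (inj₂ (inj₂ _))) = refl
  from-to : ∀ c → from (to c) ≡ c
  from-to (m2 , _) = refl
  from-to (m1 , _) = refl
  from-to (p1 , _) = refl
  from-to (p2 , _) = refl

stepSum : ℕ → ℕ → ℕ
stepSum h n = reach m2 + (reach m1 + (reach p1 + reach p2))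
  where
  reach : Step → ℕ
  reach s = landingCount (+ h +ℤ stepVal s) n

X-step : ∀ h n → X h (suc n) ≡ stepSum h n
X-step 0 n = trans (X-from-0 (suc n)) (shift-suc _ n)
X-step 1 n = trans (X-from-1 (suc n)) (shift-suc _ n)
X-step 2 n = trans (X-from-2 (suc n)) (shift-suc _ n)
X-step (suc (suc (suc k))) n =
  trans (X-from-high k (suc n))
  (trans (shift-suc _ n)
         (cong (λ m → X (suc k) n + (X (2 + k) n + m))
               (cong₂ _+_ (cong (λ h → X h n) (+-comm 1 (3 + k))) (cong (λ h → X h n) (+-comm 2 (3 + k))))))

walk-count-empty : ∀ h → Walks h 0 ↔ Fin (X h 0)
walk-count-empty 0 = ↔-trans (empty↔Fin0 (λ { ([] , ()) })) (Fin-cong (sym (X-from-0 0)))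
walk-count-empty 1 = ↔-trans (empty↔Fin0 (λ { ([] , ()) })) (Fin-cong (sym (X-from-1 0)))
walk-count-empty 2 = ↔-trans (mk↔ₛ′ (λ _ → tt) (λ _ → [] , refl) (λ _ → refl) (λ { ([] , refl) → refl }))
                    (↔-trans (↔-sym 1↔⊤) (Fin-cong (sym (X-from-2 0))))
walk-count-empty (suc (suc (suc k))) = ↔-trans (empty↔Fin0 (λ { ([] , ()) })) (Fin-cong (sym (X-from-high k 0)))

walk-count : ∀ n h → Walks h n ↔ Fin (X h n)
walk-count zero    h = walk-count-empty h
walk-count (suc n) h =
  ↔-trans (walks-first-step h n)
  (↔-trans (Σ-↔ ↔-refl (↔-trans (landing _ n) (landing-count n (walk-count n) _)))
  (↔-trans (Σ-Step _)
  (↔-trans (↔-sym Fin-+₄)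
  (Fin-cong (sym (X-step h n))))))

mainTheorem19 : (n : ℕ) →
    Σ (Bracketing (suc n)) (λ t → value t ≡ true) ↔ Σ (Vec Step n) (GoodWalk n)
mainTheorem19 n = begin
  Valued true n  ↔⟨ valued-count n true ⟩
  Fin (ω n)      ↔⟨ Fin-cong (o-walk n) ⟩
  Fin (X 0 n)    ↔⟨ walk-count n 0 ⟨
  Walks 0 n      ∎
  where open EquationalReasoning
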